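{- Let $v$, $k$ and $\lambda$ be positive integers such that $3 \leq k < v$, let $\mathcal{D}$ be a $(v,k,\lambda)$-covering or -packing on $[v]$, and let $G$ be the excess or leave of $\mathcal{D}$. Let $r=r(\mathcal{D})$, $d=d(\mathcal{D})$, $V_i=V_i(\mathcal{D})$ for $i \in \{0,1\}$, and suppose $d<r-\lambda$. Let $m=r-\lambda+1$ if $\mathcal{D}$ is a covering and $m=r-\lambda-1$ if $\mathcal{D}$ is a packing. Let $c$ be a real number such that $\frac{d}{r-\lambda} < c < 1$ and let $G^*$ be the edge-weighted graph on vertex set $V_0 \cup V_1$ such that $\mathrm{wt}_{G^*}(uw)=\mu_G(uw)$ for all distinct $u,w \in V_1$; $\mathrm{wt}_{G^*}(uw)=c\,\mu_G(uw)$ for all $u \in V_0$, $w \in V_1$; and $\mathrm{wt}_{G^*}(uw)=0$ for all distinct $u,w \in V_0$. If $S$ is an $m$-independent set in $G^*$, then $\mathcal{D}$ has at least $|S|$ blocks.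
   Context: A $(v,k,\lambda)$-covering (resp. packing) is a pair $([v],\mathcal{B})$ where $\mathcal{B}$ is a collection of $k$-subsets of $[v]=\{1,\dots,v\}$ (blocks) such that every pair of distinct points lies together in at least (resp. at most) $\lambda$ blocks. The excess (covering) or leave (packing) of $\mathcal{D}$ is the multigraph $G$ on $[v]$ with edge multiplicities $\mu_G(uw)=|r_{\mathcal{D}}(uw)-\lambda|$, where $r_{\mathcal{D}}(uw)$ is the number of blocks containing both $u$ and $w$. For a covering, $r(\mathcal{D}),d(\mathcal{D})$ are the integers with $\lambda(v-1)=r(k-1)-d$, $0\le d<k-1$; for a packing, the integers with $\lambda(v-1)=r(k-1)+d$, $0\le d<k-1$. For a nonnegative integer $i$, $V_i(\mathcal{D})=\{u\in[v]:\deg_G(u)=d+i(k-1)\}$. An edge-weighted graph is a complete simple graph with nonnegative real edge weights; the weight of a vertex $u$ in an induced subgraph $G^*[S]$ is $\mathrm{wt}_{G^*[S]}(u)=\sum_{w\in S\setminus\{u\}}\mathrm{wt}_{G^*}(uw)$, and $S$ is $m$-independent in $G^*$ if $\mathrm{wt}_{G^*[S]}(u)<m$ for all $u\in S$.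
   Formalization: The number $c$ with $\frac{d}{r-\lambda} < c < 1$ is taken to be rational rather than real. -}

module Defs where

open import Data.Bool using (Bool; true; false; if_then_else_; _∧_; not)
open import Data.Nat using (ℕ; zero; suc; _+_; _*_; _∸_; _≤_; _<_; ∣_-_∣)
import Data.Nat as ℕ
open import Data.Fin using (Fin; _≟_)
import Data.Fin as Fin
open import Data.Fin.Subset using (Subset; ∣_∣; _∈_)
open import Data.Vec using (lookup)
open import Data.List using (List; []; _∷_)
open import Data.List.Relation.Unary.All using (All)
open import Data.Product using (_×_)
open import Data.Sum using (_⊎_)
open import Data.Integer using (+_)
open import Data.Rational using (ℚ; 0ℚ; _/_)
import Data.Rational as ℚ
open import Relation.Nullary.Decidable using (⌊_⌋)
open import Relation.Binary.PropositionalEquality using (_≡_; _≢_)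

-- Throughout, `lam` is the paper's λ (λ is an Agda keyword).

-- A design on [v] = Fin v : a list (multiset) of blocks, each a subset of Fin v.
Design : ℕ → Set
Design v = List (Subset v)

KUniform : ∀ {v} → ℕ → Design v → Set
KUniform k 𝓑 = All (λ b → ∣ b ∣ ≡ k) 𝓑

pairCount : ∀ {v} → Design v → Fin v → Fin v → ℕ
pairCount [] u w = 0
pairCount (b ∷ 𝓑) u w =
  (if lookup b u ∧ lookup b w then 1 else 0) + pairCount 𝓑 u w

data Kind : Set where
  covering packing : Kind

IsDesign : Kind → (v k lam : ℕ) → Design v → Set
IsDesign covering v k lam 𝓑 =
  KUniform k 𝓑 × (∀ (u w : Fin v) → u ≢ w → lam ≤ pairCount 𝓑 u w)
IsDesign packing v k lam 𝓑 =
  KUniform k 𝓑 × (∀ (u w : Fin v) → u ≢ w → pairCount 𝓑 u w ≤ lam)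

-- r = r(D), d = d(D), characterised by their defining equations
-- (covering: lam(v-1) = r(k-1) - d; packing: lam(v-1) = r(k-1) + d; 0 ≤ d < k-1).
-- These determine r and d uniquely.
IsRD : Kind → (v k lam r d : ℕ) → Set
IsRD covering v k lam r d = (lam * (v ∸ 1) + d ≡ r * (k ∸ 1)) × (d < k ∸ 1)
IsRD packing v k lam r d = (lam * (v ∸ 1) ≡ r * (k ∸ 1) + d) × (d < k ∸ 1)

sumℕ : ∀ {n} → (Fin n → ℕ) → ℕ
sumℕ {zero} f = 0
sumℕ {suc n} f = f Fin.zero + sumℕ (λ i → f (Fin.suc i))

sumℚ : ∀ {n} → (Fin n → ℚ) → ℚ
sumℚ {zero} f = 0ℚ
sumℚ {suc n} f = f Fin.zero ℚ.+ sumℚ (λ i → f (Fin.suc i))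

-- μ_G(uw) = |r_D(uw) - lam|, multiplicity of uw in the excess / leave G
-- (G is loopless: 0 on the diagonal)
μ : ∀ {v} → ℕ → Design v → Fin v → Fin v → ℕ
μ lam 𝓑 u w = if ⌊ u ≟ w ⌋ then 0 else ∣ pairCount 𝓑 u w - lam ∣

deg : ∀ {v} → ℕ → Design v → Fin v → ℕ
deg lam 𝓑 u = sumℕ (λ w → μ lam 𝓑 u w)

inV : ∀ {v} → (k lam d i : ℕ) → Design v → Fin v → Bool
inV k lam d i 𝓑 u = ⌊ deg lam 𝓑 u ℕ.≟ d + i * (k ∸ 1) ⌋

toℚ : ℕ → ℚ
toℚ n = (+ n) / 1

-- weight of the edge uw in G* (used for distinct u, w ∈ V_0 ∪ V_1):
--   both in V_1 : μ(uw);  both in V_0 : 0;  one in V_0, other in V_1 : c μ(uw).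
-- (V_0 and V_1 are disjoint since k - 1 > 0.)
wtG* : ∀ {v} → (k lam d : ℕ) → (c : ℚ) → Design v → Fin v → Fin v → ℚ
wtG* k lam d c 𝓑 u w =
  if inV k lam d 1 𝓑 u ∧ inV k lam d 1 𝓑 w then toℚ (μ lam 𝓑 u w)
  else if inV k lam d 0 𝓑 u ∧ inV k lam d 0 𝓑 w then 0ℚ
  else c ℚ.* toℚ (μ lam 𝓑 u w)

wtIn : ∀ {v} → (k lam d : ℕ) → (c : ℚ) → Design v → Subset v → Fin v → ℚ
wtIn k lam d c 𝓑 S u =
  sumℚ (λ w → if lookup S w ∧ not ⌊ u ≟ w ⌋ then wtG* k lam d c 𝓑 u w else 0ℚ)

InVertexSet : ∀ {v} → (k lam d : ℕ) → Design v → Subset v → Set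
InVertexSet k lam d 𝓑 S =
  ∀ u → u ∈ S → (inV k lam d 0 𝓑 u ≡ true) ⊎ (inV k lam d 1 𝓑 u ≡ true)

MIndependent : ∀ {v} → (k lam d : ℕ) → (c : ℚ) → Design v → ℚ → Subset v → Set
MIndependent k lam d c 𝓑 m S = ∀ u → u ∈ S → wtIn k lam d c 𝓑 S u ℚ.< m

-- m = r - lam + 1 (covering), r - lam - 1 (packing); used only when r > lam,
-- so the truncated subtraction is exact.
mOf : Kind → (r lam : ℕ) → ℕ
mOf covering r lam = r ∸ lam + 1
mOf packing r lam = r ∸ lam ∸ 1

-- Weight the points of S by q on V₁ and by p on V₀, where c = p / q, and suppose
-- |S| > |𝓑|.  Then some nonzero integer vector y supported on S makes x = s·y sum to
-- zero over every block, so the Gram form Σ_{u,w} r_𝓑(uw) x_u x_w = Σ_B (Σ_{u∈B} x_u)²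
-- vanishes.  But r_𝓑(uw) = λ + [u = w](r_u − λ) ± μ(uw), where the replication number
-- r_u equals r ± 1 on V₁ and r on V₀, and m-independence (on V₁) together with
-- d < c(r − λ) (on V₀) say exactly that (r_u − λ)[u = w] ± μ(uw) is strictly diagonally
-- dominant on S with respect to the weights s; so the Gram form is positive.
module Submission where

open import Defs

module _ where

  open import Data.Bool using (Bool; true; false; if_then_else_; _∧_; not)
  open import Data.Bool.Properties using (∧-comm)
  open import Data.Empty using (⊥; ⊥-elim)
  open import Data.Fin using (Fin; zero; suc; _≟_)
  open import Data.Fin.Properties using (any?)
  open import Data.Fin.Subset using (Subset; inside; outside; ∣_∣; _∈_; _∉_; _─_; ⁅_⁆; Nonempty)
  open import Data.Fin.Subset.Properties using (_∈?_; p─⊥≡p; p─q⊆p)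
  open import Data.Integer using (ℤ; +_; -[1+_]; 0ℤ; 1ℤ; -_; _+_; _-_; _*_; _≤_; _<_; +≤+; +<+)
  import Data.Integer as ℤ
  import Data.Integer.Properties as ℤP
  open import Algebra.Properties.Semiring.Sum ℤP.+-*-semiring
    using (sum; sum-syntax; sum-cong-≗; sum-replicate-zero; ∑-distrib-+; ∑-comm; *-distribˡ-sum; *-distribʳ-sum)
  open import Data.Integer.Tactic.RingSolver using (solve-∀)
  open import Data.List using ([]; _∷_)
  import Data.List as List
  open import Data.List.Relation.Unary.All using ([]; _∷_)
  open import Data.Nat using (ℕ; zero; suc; z≤n; s≤s)
  import Data.Nat as ℕ
  import Data.Nat.Properties as ℕP
  open import Data.Product using (_,_; ∃; proj₁)
  open import Data.Rational using (ℚ; mkℚ; 0ℚ)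
  import Data.Rational as ℚ
  import Data.Rational.Properties as ℚP
  open import Data.Rational.Unnormalised as ℚᵘ using (mkℚᵘ; *≡*; *<*)
  import Data.Rational.Unnormalised.Properties as ℚᵘP
  open import Data.Sum using ([_,_]′)
  open import Data.Vec using ([]; _∷_; here; there; lookup)
  open import Data.Vec.Properties using ([]=⇒lookup)
  open import Function using (_∘_; id)
  open import Relation.Binary.PropositionalEquality
  open import Relation.Nullary using (yes; no; _×-dec_; ¬?; contradiction)
  open import Relation.Nullary.Decidable using (does; ⌊_⌋; dec-true; dec-false; decidable-stable)

  pos-∸ : ∀ {m n} → n ℕ.≤ m → + (m ℕ.∸ n) ≡ + m - + n
  pos-∸ {m} {n} n≤m = trans (sym (ℤP.⊖-≥ n≤m)) (sym (ℤP.m-n≡m⊖n m n))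

  nonNeg*nonNeg : ∀ {i j} → 0ℤ ≤ i → 0ℤ ≤ j → 0ℤ ≤ i * j
  nonNeg*nonNeg {+ m} {+ n} _ _ = subst (0ℤ ≤_) (ℤP.pos-* m n) (+≤+ z≤n)

  pos*pos : ∀ {i j} → 0ℤ < i → 0ℤ < j → 0ℤ < i * j
  pos*pos {+ zero}            (+<+ ()) _
  pos*pos {+ suc m} {+ zero}  _        (+<+ ())
  pos*pos {+ suc m} {+ suc n} _        _        = +<+ (s≤s z≤n)

  square-nonNeg : ∀ i → 0ℤ ≤ i * i
  square-nonNeg (+ n)    = nonNeg*nonNeg {+ n} {+ n} (+≤+ z≤n) (+≤+ z≤n)
  square-nonNeg -[1+ n ] = +≤+ z≤n

  square-pos : ∀ {i} → i ≢ 0ℤ → 0ℤ < i * i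
  square-pos {+ zero}    i≢0 = contradiction refl i≢0
  square-pos {+ suc n}   _   = +<+ (s≤s z≤n)
  square-pos { -[1+ n ]} _   = +<+ (s≤s z≤n)

  ∑-const : ∀ n (a : ℤ) → ∑[ i < n ] a ≡ + n * a
  ∑-const zero    a = sym (ℤP.*-zeroˡ a)
  ∑-const (suc n) a = trans (cong (_+_ a) (∑-const n a)) (sym (ℤP.suc-* (+ n) a))

  ∑-zero : ∀ n {f : Fin n → ℤ} → (∀ i → f i ≡ 0ℤ) → ∑[ i < n ] f i ≡ 0ℤ
  ∑-zero n f≗0 = trans (sum-cong-≗ f≗0) (sum-replicate-zero n)

  ∑-neg : ∀ {n} (f : Fin n → ℤ) → ∑[ i < n ] (- f i) ≡ - ∑[ i < n ] f i
  ∑-neg {zero}  f = refl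
  ∑-neg {suc n} f = trans (cong (_+_ (- f zero)) (∑-neg (λ i → f (suc i))))
                          (sym (ℤP.neg-distrib-+ (f zero) (∑[ i < n ] f (suc i))))

  ∑-distrib-minus : ∀ {n} (f g : Fin n → ℤ) → ∑[ i < n ] (f i - g i) ≡ ∑[ i < n ] f i - ∑[ i < n ] g i
  ∑-distrib-minus f g = trans (∑-distrib-+ f (λ i → - g i)) (cong (_+_ (sum f)) (∑-neg g))

  ∑∑-distrib-+ : ∀ {n} (f g : Fin n → Fin n → ℤ) →
    ∑[ u < n ] ∑[ w < n ] (f u w + g u w) ≡ ∑[ u < n ] ∑[ w < n ] f u w + ∑[ u < n ] ∑[ w < n ] g u w
  ∑∑-distrib-+ {n} f g = trans (sum-cong-≗ λ u → ∑-distrib-+ (f u) (g u))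
                               (∑-distrib-+ (λ u → ∑[ w < n ] f u w) (λ u → ∑[ w < n ] g u w))

  ∑∑-product : ∀ {n} (f g : Fin n → ℤ) → ∑[ u < n ] ∑[ w < n ] (f u * g w) ≡ sum f * sum g
  ∑∑-product {n} f g = begin
    ∑[ u < n ] ∑[ w < n ] (f u * g w)  ≡⟨ sum-cong-≗ (λ u → *-distribˡ-sum (f u) g) ⟨
    ∑[ u < n ] (f u * sum g)           ≡⟨ *-distribʳ-sum (sum g) f ⟨
    sum f * sum g                      ∎
    where open ≡-Reasoning

  ∑-mono-≤ : ∀ {n} {f g : Fin n → ℤ} → (∀ i → f i ≤ g i) → ∑[ i < n ] f i ≤ ∑[ i < n ] g i
  ∑-mono-≤ {zero}  f≤g = ℤP.≤-refl
  ∑-mono-≤ {suc n} f≤g = ℤP.+-mono-≤ (f≤g zero) (∑-mono-≤ (λ i → f≤g (suc i)))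

  ∑-nonNeg : ∀ {n} {f : Fin n → ℤ} → (∀ i → 0ℤ ≤ f i) → 0ℤ ≤ ∑[ i < n ] f i
  ∑-nonNeg {n} {f} 0≤f = subst (_≤ sum f) (sum-replicate-zero n) (∑-mono-≤ 0≤f)

  ∑-pos : ∀ {n} {f : Fin n → ℤ} → (∀ i → 0ℤ ≤ f i) → ∀ j → 0ℤ < f j → 0ℤ < ∑[ i < n ] f i
  ∑-pos 0≤f zero    0<fj = ℤP.+-mono-<-≤ 0<fj (∑-nonNeg (λ i → 0≤f (suc i)))
  ∑-pos 0≤f (suc j) 0<fj = ℤP.+-mono-≤-< (0≤f zero) (∑-pos (λ i → 0≤f (suc i)) j 0<fj)

  pos-sumℕ : ∀ {n} (f : Fin n → ℕ) → + sumℕ f ≡ ∑[ i < n ] (+ f i)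
  pos-sumℕ {zero}  f = refl
  pos-sumℕ {suc n} f = trans (ℤP.pos-+ (f zero) (sumℕ (λ i → f (suc i))))
                             (cong (_+_ (+ f zero)) (pos-sumℕ (λ i → f (suc i))))

  δ : ∀ {n} → Fin n → Fin n → ℤ
  δ i j = if does (i ≟ j) then 1ℤ else 0ℤ

  δ-refl : ∀ {n} (i : Fin n) → δ i i ≡ 1ℤ
  δ-refl i = cong (if_then 1ℤ else 0ℤ) (dec-true (i ≟ i) refl)

  δ-≢ : ∀ {n} {i j : Fin n} → i ≢ j → δ i j ≡ 0ℤ
  δ-≢ {i = i} {j} i≢j = cong (if_then 1ℤ else 0ℤ) (dec-false (i ≟ j) i≢j)

  ∑-δ : ∀ {n} (i : Fin n) (f : Fin n → ℤ) → ∑[ j < n ] (δ i j * f j) ≡ f i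
  ∑-δ {suc n} zero    f = begin
    1ℤ * f zero + ∑[ j < n ] (0ℤ * f (suc j))  ≡⟨ cong₂ _+_ (ℤP.*-identityˡ (f zero)) (∑-zero n λ j → ℤP.*-zeroˡ (f (suc j))) ⟩
    f zero + 0ℤ                                ≡⟨ ℤP.+-identityʳ (f zero) ⟩
    f zero                                     ∎
    where open ≡-Reasoning
  ∑-δ {suc n} (suc i) f = begin
    0ℤ * f zero + ∑[ j < n ] (δ i j * f (suc j))  ≡⟨ cong (_+ ∑[ j < n ] (δ i j * f (suc j))) (ℤP.*-zeroˡ (f zero)) ⟩
    0ℤ + ∑[ j < n ] (δ i j * f (suc j))           ≡⟨ ℤP.+-identityˡ (∑[ j < n ] (δ i j * f (suc j))) ⟩
    ∑[ j < n ] (δ i j * f (suc j))                ≡⟨ ∑-δ i (λ j → f (suc j)) ⟩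
    f (suc i)                                     ∎
    where open ≡-Reasoning

  -- Integer kernel vectors

  ∣p∣>0⇒nonempty : ∀ {n} (p : Subset n) → 0 ℕ.< ∣ p ∣ → Nonempty p
  ∣p∣>0⇒nonempty (inside  ∷ p) _     = zero , here
  ∣p∣>0⇒nonempty (outside ∷ p) 0<∣p∣ with ∣p∣>0⇒nonempty p 0<∣p∣
  ... | x , x∈p = suc x , there x∈p

  x∈p⇒∣p∣≡1+∣p-x∣ : ∀ {n} {x : Fin n} {p : Subset n} → x ∈ p → ∣ p ∣ ≡ suc ∣ p ─ ⁅ x ⁆ ∣
  x∈p⇒∣p∣≡1+∣p-x∣ {p = inside  ∷ p} here        = cong suc (sym (cong ∣_∣ (p─⊥≡p p)))
  x∈p⇒∣p∣≡1+∣p-x∣ {p = inside  ∷ p} (there x∈p) = cong suc (x∈p⇒∣p∣≡1+∣p-x∣ x∈p)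
  x∈p⇒∣p∣≡1+∣p-x∣ {p = outside ∷ p} (there x∈p) = x∈p⇒∣p∣≡1+∣p-x∣ x∈p

  x∉p-x : ∀ {n} (p : Subset n) (x : Fin n) → x ∉ p ─ ⁅ x ⁆
  x∉p-x (s ∷ p) zero    ()
  x∉p-x (s ∷ p) (suc x) (there x∈p-x) = x∉p-x p x x∈p-x

  infix 7 _∙_

  _∙_ : ∀ {n} → (Fin n → ℤ) → (Fin n → ℤ) → ℤ
  _∙_ {n} f x = ∑[ u < n ] (f u * x u)

  record NonzeroKernelVector {m n} (A : Fin m → Fin n → ℤ) (T : Subset n) : Set where
    field
      y         : Fin n → ℤ
      supported : ∀ u → u ∉ T → y u ≡ 0ℤ
      witness   : Fin n
      nonzero   : y witness ≢ 0ℤ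
      solves    : ∀ i → A i ∙ y ≡ 0ℤ

  eliminate : ∀ {n} → (Fin n → ℤ) → Fin n → (Fin n → ℤ) → Fin n → ℤ
  eliminate f j h u = f j * h u - h j * f u

  backSubstitute : ∀ {n} → (Fin n → ℤ) → Fin n → (Fin n → ℤ) → Fin n → ℤ
  backSubstitute f j y u = f j * y u - δ j u * (f ∙ y)

  ∙-eliminate : ∀ {n} (f : Fin n → ℤ) j h y → eliminate f j h ∙ y ≡ f j * (h ∙ y) - h j * (f ∙ y)
  ∙-eliminate {n} f j h y = begin
    ∑[ u < n ] ((f j * h u - h j * f u) * y u)
      ≡⟨ sum-cong-≗ (λ u → expand (f j) (h u) (h j) (f u) (y u)) ⟩
    ∑[ u < n ] (f j * (h u * y u) - h j * (f u * y u))
      ≡⟨ ∑-distrib-minus (λ u → f j * (h u * y u)) (λ u → h j * (f u * y u)) ⟩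
    ∑[ u < n ] (f j * (h u * y u)) - ∑[ u < n ] (h j * (f u * y u))
      ≡⟨ cong₂ _-_ (*-distribˡ-sum (f j) (λ u → h u * y u)) (*-distribˡ-sum (h j) (λ u → f u * y u)) ⟨
    f j * (h ∙ y) - h j * (f ∙ y) ∎
    where
    open ≡-Reasoning
    expand : ∀ a b c d e → (a * b - c * d) * e ≡ a * (b * e) - c * (d * e)
    expand = solve-∀

  ∙-backSubstitute : ∀ {n} (f : Fin n → ℤ) j h y → h ∙ backSubstitute f j y ≡ f j * (h ∙ y) - h j * (f ∙ y)
  ∙-backSubstitute {n} f j h y = begin
    ∑[ u < n ] (h u * (f j * y u - δ j u * (f ∙ y)))
      ≡⟨ sum-cong-≗ (λ u → expand (h u) (f j) (y u) (δ j u) (f ∙ y)) ⟩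
    ∑[ u < n ] (f j * (h u * y u) - δ j u * (h u * (f ∙ y)))
      ≡⟨ ∑-distrib-minus (λ u → f j * (h u * y u)) (λ u → δ j u * (h u * (f ∙ y))) ⟩
    ∑[ u < n ] (f j * (h u * y u)) - ∑[ u < n ] (δ j u * (h u * (f ∙ y)))
      ≡⟨ cong₂ _-_ (sym (*-distribˡ-sum (f j) (λ u → h u * y u))) (∑-δ j (λ u → h u * (f ∙ y))) ⟩
    f j * (h ∙ y) - h j * (f ∙ y) ∎
    where
    open ≡-Reasoning
    expand : ∀ a b c d e → a * (b * c - d * e) ≡ b * (a * c) - d * (a * e)
    expand = solve-∀

  disjoint-supports⇒∙≡0 : ∀ {n} (f y : Fin n → ℤ) (T : Subset n) →
    (∀ u → u ∈ T → f u ≡ 0ℤ) → (∀ u → u ∉ T → y u ≡ 0ℤ) → f ∙ y ≡ 0ℤ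
  disjoint-supports⇒∙≡0 {n} f y T f≡0 y≡0 = ∑-zero n term≡0
    where
    term≡0 : ∀ u → f u * y u ≡ 0ℤ
    term≡0 u with u ∈? T
    ... | yes u∈T = trans (cong (_* y u) (f≡0 u u∈T)) (ℤP.*-zeroˡ (y u))
    ... | no  u∉T = trans (cong (f u *_) (y≡0 u u∉T)) (ℤP.*-zeroʳ (f u))

  -- Gaussian elimination, pivoting on an entry of the first row inside T.
  nonzeroKernelVector : ∀ {m n} (A : Fin m → Fin n → ℤ) (T : Subset n) → m ℕ.< ∣ T ∣ → NonzeroKernelVector A T
  nonzeroKernelVector {zero} A T 0<∣T∣ with ∣p∣>0⇒nonempty T 0<∣T∣
  ... | j , j∈T = record
    { y         = δ j
    ; supported = λ u u∉T → δ-≢ (λ j≡u → u∉T (subst (_∈ T) j≡u j∈T))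
    ; witness   = j
    ; nonzero   = λ δjj≡0 → 1≢0 (trans (sym (δ-refl j)) δjj≡0)
    ; solves    = λ ()
    }
    where
    1≢0 : 1ℤ ≢ 0ℤ
    1≢0 ()
  nonzeroKernelVector {suc m} A T m<∣T∣ with any? (λ j → (j ∈? T) ×-dec ¬? (A zero j ℤ.≟ 0ℤ))
  ... | no noPivot = record
    { y         = y
    ; supported = supported
    ; witness   = witness
    ; nonzero   = nonzero
    ; solves    = λ { zero → disjoint-supports⇒∙≡0 (A zero) y T row₀≡0 supported ; (suc i) → solves i }
    }
    where
    open NonzeroKernelVector (nonzeroKernelVector (λ i → A (suc i)) T (ℕP.<⇒≤ m<∣T∣))
    row₀≡0 : ∀ u → u ∈ T → A zero u ≡ 0ℤ
    row₀≡0 u u∈T = decidable-stable (A zero u ℤ.≟ 0ℤ) (λ A₀u≢0 → noPivot (u , u∈T , A₀u≢0))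
  ... | yes (j , j∈T , pivot≢0) = record
    { y         = backSubstitute f j y
    ; supported = supported′
    ; witness   = witness
    ; nonzero   = nonzero′
    ; solves    = solves′
    }
    where
    f = A zero
    open NonzeroKernelVector (nonzeroKernelVector (λ i → eliminate f j (A (suc i))) (T ─ ⁅ j ⁆)
                                                  (ℕ.s<s⁻¹ (subst (suc m ℕ.<_) (x∈p⇒∣p∣≡1+∣p-x∣ j∈T) m<∣T∣)))
    supported′ : ∀ u → u ∉ T → backSubstitute f j y u ≡ 0ℤ
    supported′ u u∉T = begin
      f j * y u - δ j u * (f ∙ y)
        ≡⟨ cong₂ (λ a b → f j * a - b * (f ∙ y)) (supported u (u∉T ∘ p─q⊆p T ⁅ j ⁆)) (δ-≢ j≢u) ⟩
      f j * 0ℤ - 0ℤ * (f ∙ y)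
        ≡⟨ vanish (f j) (f ∙ y) ⟩
      0ℤ ∎
      where
      open ≡-Reasoning
      j≢u : j ≢ u
      j≢u j≡u = u∉T (subst (_∈ T) j≡u j∈T)
      vanish : ∀ a b → a * 0ℤ - 0ℤ * b ≡ 0ℤ
      vanish = solve-∀
    nonzero′ : backSubstitute f j y witness ≢ 0ℤ
    nonzero′ x≡0 = [ pivot≢0 , nonzero ]′ (ℤP.i*j≡0⇒i≡0∨j≡0 (f j) fj*y≡0)
      where
      open ≡-Reasoning
      j≢witness : j ≢ witness
      j≢witness j≡witness = nonzero (supported witness (subst (_∉ T ─ ⁅ j ⁆) j≡witness (x∉p-x T j)))
      drop-zero : ∀ a b → a - 0ℤ * b ≡ a
      drop-zero = solve-∀
      fj*y≡0 : f j * y witness ≡ 0ℤ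
      fj*y≡0 = begin
        f j * y witness                 ≡⟨ drop-zero (f j * y witness) (f ∙ y) ⟨
        f j * y witness - 0ℤ * (f ∙ y)  ≡⟨ cong (λ b → f j * y witness - b * (f ∙ y)) (δ-≢ j≢witness) ⟨
        backSubstitute f j y witness    ≡⟨ x≡0 ⟩
        0ℤ                              ∎
    solves′ : ∀ i → A i ∙ backSubstitute f j y ≡ 0ℤ
    solves′ zero    = trans (∙-backSubstitute f j f y) (ℤP.+-inverseʳ (f j * (f ∙ y)))
    solves′ (suc i) = begin
      A (suc i) ∙ backSubstitute f j y               ≡⟨ ∙-backSubstitute f j (A (suc i)) y ⟩
      f j * (A (suc i) ∙ y) - A (suc i) j * (f ∙ y)  ≡⟨ ∙-eliminate f j (A (suc i)) y ⟨
      eliminate f j (A (suc i)) ∙ y                  ≡⟨ solves i ⟩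
      0ℤ                                             ∎
      where open ≡-Reasoning

  -- Quadratic forms

  quadraticForm : ∀ {n} → (Fin n → Fin n → ℤ) → (Fin n → ℤ) → ℤ
  quadraticForm {n} P x = ∑[ u < n ] ∑[ w < n ] (P u w * (x u * x w))

  quadraticForm-+ : ∀ {n} (P Q : Fin n → Fin n → ℤ) x →
    quadraticForm (λ u w → P u w + Q u w) x ≡ quadraticForm P x + quadraticForm Q x
  quadraticForm-+ P Q x = trans
    (sum-cong-≗ λ u → sum-cong-≗ λ w → ℤP.*-distribʳ-+ (x u * x w) (P u w) (Q u w))
    (∑∑-distrib-+ (λ u w → P u w * (x u * x w)) (λ u w → Q u w * (x u * x w)))

  quadraticForm-* : ∀ {n} (c : ℤ) (P : Fin n → Fin n → ℤ) x →
    quadraticForm (λ u w → c * P u w) x ≡ c * quadraticForm P x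
  quadraticForm-* {n} c P x = sym (trans
    (*-distribˡ-sum c (λ u → ∑[ w < n ] (P u w * (x u * x w))))
    (sum-cong-≗ λ u → trans (*-distribˡ-sum c (λ w → P u w * (x u * x w)))
                            (sum-cong-≗ λ w → sym (ℤP.*-assoc c (P u w) (x u * x w)))))

  quadraticForm-const : ∀ {n} (c : ℤ) (x : Fin n → ℤ) → quadraticForm (λ _ _ → c) x ≡ c * (sum x * sum x)
  quadraticForm-const {n} c x = begin
    ∑[ u < n ] ∑[ w < n ] (c * (x u * x w))  ≡⟨ sum-cong-≗ (λ u → sum-cong-≗ λ w → ℤP.*-assoc c (x u) (x w)) ⟨
    ∑[ u < n ] ∑[ w < n ] (c * x u * x w)    ≡⟨ ∑∑-product (λ u → c * x u) x ⟩
    sum (λ u → c * x u) * sum x              ≡⟨ cong (_* sum x) (*-distribˡ-sum c x) ⟨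
    c * sum x * sum x                        ≡⟨ ℤP.*-assoc c (sum x) (sum x) ⟩
    c * (sum x * sum x)                      ∎
    where open ≡-Reasoning

  quadraticForm-rank1 : ∀ {n} (a x : Fin n → ℤ) → quadraticForm (λ u w → a u * a w) x ≡ (a ∙ x) * (a ∙ x)
  quadraticForm-rank1 a x = trans (sum-cong-≗ λ u → sum-cong-≗ λ w → regroup (a u) (a w) (x u) (x w))
                                  (∑∑-product (λ u → a u * x u) (λ w → a w * x w))
    where
    regroup : ∀ a b c d → a * b * (c * d) ≡ a * c * (b * d)
    regroup = solve-∀

  quadraticForm-diagonal : ∀ {n} (D x : Fin n → ℤ) →
    quadraticForm (λ u w → δ u w * D u) x ≡ ∑[ u < n ] (D u * (x u * x u))
  quadraticForm-diagonal D x = sum-cong-≗ λ u → trans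
    (sum-cong-≗ λ w → ℤP.*-assoc (δ u w) (D u) (x u * x w))
    (∑-δ u (λ w → D u * (x u * x w)))

  quadraticForm-structured : ∀ {n} (P M : Fin n → Fin n → ℤ) (L σ : ℤ) (D : Fin n → ℤ) →
    (∀ u w → P u w ≡ L + δ u w * D u + σ * M u w) → ∀ x →
    quadraticForm P x ≡ L * (sum x * sum x) + ∑[ u < n ] (D u * (x u * x u)) + σ * quadraticForm M x
  quadraticForm-structured {n} P M L σ D P≡ x = begin
    quadraticForm P x
      ≡⟨ sum-cong-≗ (λ u → sum-cong-≗ λ w → cong (_* (x u * x w)) (P≡ u w)) ⟩
    quadraticForm (λ u w → L + δ u w * D u + σ * M u w) x
      ≡⟨ quadraticForm-+ (λ u w → L + δ u w * D u) (λ u w → σ * M u w) x ⟩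
    quadraticForm (λ u w → L + δ u w * D u) x + quadraticForm (λ u w → σ * M u w) x
      ≡⟨ cong₂ _+_ (quadraticForm-+ (λ _ _ → L) (λ u w → δ u w * D u) x) (quadraticForm-* σ M x) ⟩
    quadraticForm (λ _ _ → L) x + quadraticForm (λ u w → δ u w * D u) x + σ * quadraticForm M x
      ≡⟨ cong₂ (λ a b → a + b + σ * quadraticForm M x) (quadraticForm-const L x) (quadraticForm-diagonal D x) ⟩
    L * (sum x * sum x) + ∑[ u < n ] (D u * (x u * x u)) + σ * quadraticForm M x ∎
    where open ≡-Reasoning

  module WeightedDominance {n} (M : Fin n → Fin n → ℤ) (D : Fin n → ℤ) (σ : ℤ) (s : Fin n → ℕ) (y : Fin n → ℤ) where

    sℤ : Fin n → ℤ
    sℤ u = + s u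

    x : Fin n → ℤ
    x u = sℤ u * y u

    Z : Fin n → ℤ
    Z u = ∑[ w < n ] (M u w * sℤ w)

    slack : Fin n → ℤ
    slack u = sℤ u * (y u * y u) * (sℤ u * D u - Z u)

    radius : ℤ
    radius = ∑[ u < n ] (sℤ u * (y u * y u) * Z u)

    squares : Fin n → Fin n → ℤ
    squares u w = M u w * (sℤ u * sℤ w) * ((y u + σ * y w) * (y u + σ * y w))

    diagonal-split : ∑[ u < n ] (D u * (x u * x u)) ≡ sum slack + radius
    diagonal-split = trans (sum-cong-≗ λ u → split (sℤ u) (y u) (D u) (Z u))
                           (∑-distrib-+ slack (λ u → sℤ u * (y u * y u) * Z u))
      where
      split : ∀ a b c d → c * ((a * b) * (a * b)) ≡ a * (b * b) * (a * c - d) + a * (b * b) * d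
      split = solve-∀

    -- Completing the square: 2σ M_uw x_u x_w ≥ − M_uw s_u s_w (y_u² + y_w²) when σ² = 1.
    cross-terms : (∀ u w → M u w ≡ M w u) → σ * σ ≡ 1ℤ →
      ∑[ u < n ] ∑[ w < n ] squares u w ≡ radius + radius + + 2 * σ * quadraticForm M x
    cross-terms M-sym σ²≡1 = begin
      ∑[ u < n ] ∑[ w < n ] squares u w
        ≡⟨ sum-cong-≗ (λ u → sum-cong-≗ λ w → expand u w) ⟩
      ∑[ u < n ] ∑[ w < n ] (left u w + left w u + mixed u w)
        ≡⟨ ∑∑-distrib-+ (λ u w → left u w + left w u) mixed ⟩
      ∑[ u < n ] ∑[ w < n ] (left u w + left w u) + quadraticForm (λ u w → + 2 * σ * M u w) x
        ≡⟨ cong₂ _+_ (∑∑-distrib-+ left (λ u w → left w u)) (quadraticForm-* (+ 2 * σ) M x) ⟩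
      ∑[ u < n ] ∑[ w < n ] left u w + ∑[ u < n ] ∑[ w < n ] left w u + + 2 * σ * quadraticForm M x
        ≡⟨ cong (λ t → ∑[ u < n ] ∑[ w < n ] left u w + t + + 2 * σ * quadraticForm M x) (∑-comm (λ u w → left w u)) ⟩
      ∑[ u < n ] ∑[ w < n ] left u w + ∑[ w < n ] ∑[ u < n ] left w u + + 2 * σ * quadraticForm M x
        ≡⟨ cong (λ t → t + t + + 2 * σ * quadraticForm M x) (sum-cong-≗ λ u → left-row u) ⟩
      radius + radius + + 2 * σ * quadraticForm M x ∎
      where
      open ≡-Reasoning
      left mixed : Fin n → Fin n → ℤ
      left u w = sℤ u * (y u * y u) * (M u w * sℤ w)
      mixed u w = + 2 * σ * M u w * (x u * x w)
      left-row : ∀ u → ∑[ w < n ] left u w ≡ sℤ u * (y u * y u) * Z u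
      left-row u = sym (*-distribˡ-sum (sℤ u * (y u * y u)) (λ w → M u w * sℤ w))
      square-expansion : ∀ m su sw yu yw σ → m * (su * sw) * ((yu + σ * yw) * (yu + σ * yw))
        ≡ su * (yu * yu) * (m * sw) + σ * σ * (sw * (yw * yw) * (m * su)) + + 2 * σ * m * ((su * yu) * (sw * yw))
      square-expansion = solve-∀
      expand : ∀ u w → squares u w ≡ left u w + left w u + mixed u w
      expand u w = trans (square-expansion (M u w) (sℤ u) (sℤ w) (y u) (y w) σ) (cong (λ t → left u w + t + mixed u w) (begin
        σ * σ * (sℤ w * (y w * y w) * (M u w * sℤ u))  ≡⟨ cong (_* (sℤ w * (y w * y w) * (M u w * sℤ u))) σ²≡1 ⟩
        1ℤ * (sℤ w * (y w * y w) * (M u w * sℤ u))     ≡⟨ ℤP.*-identityˡ (sℤ w * (y w * y w) * (M u w * sℤ u)) ⟩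
        sℤ w * (y w * y w) * (M u w * sℤ u)            ≡⟨ cong (λ m → sℤ w * (y w * y w) * (m * sℤ u)) (M-sym u w) ⟩
        left w u                                      ∎))

    form-positive : (∀ u w → M u w ≡ M w u) → (∀ u w → 0ℤ ≤ M u w) → σ * σ ≡ 1ℤ →
      (∀ u → y u ≢ 0ℤ → Z u < sℤ u * D u) → ∀ u₀ → y u₀ ≢ 0ℤ →
      0ℤ < ∑[ u < n ] (D u * (x u * x u)) + σ * quadraticForm M x
    form-positive M-sym M≥0 σ²≡1 dominant u₀ y₀≢0 =
      ℤP.*-cancelˡ-<-nonNeg (+ 2) (subst (0ℤ <_) (sym doubled)
        (ℤP.+-mono-<-≤ (pos*pos {+ 2} (+<+ (s≤s z≤n)) (∑-pos slack-nonNeg u₀ slack₀-pos)) squares-nonNeg))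
      where
      open ≡-Reasoning
      Q = quadraticForm M x
      regroup : ∀ w a σ q → + 2 * (w + a + σ * q) ≡ + 2 * w + (a + a + + 2 * σ * q)
      regroup = solve-∀
      doubled : + 2 * (∑[ u < n ] (D u * (x u * x u)) + σ * Q) ≡ + 2 * sum slack + ∑[ u < n ] ∑[ w < n ] squares u w
      doubled = begin
        + 2 * (∑[ u < n ] (D u * (x u * x u)) + σ * Q)       ≡⟨ cong (λ t → + 2 * (t + σ * Q)) diagonal-split ⟩
        + 2 * (sum slack + radius + σ * Q)                   ≡⟨ regroup (sum slack) radius σ Q ⟩
        + 2 * sum slack + (radius + radius + + 2 * σ * Q)    ≡⟨ cong (_+_ (+ 2 * sum slack)) (cross-terms M-sym σ²≡1) ⟨
        + 2 * sum slack + ∑[ u < n ] ∑[ w < n ] squares u w  ∎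
      squares-nonNeg : 0ℤ ≤ ∑[ u < n ] ∑[ w < n ] squares u w
      squares-nonNeg = ∑-nonNeg λ u → ∑-nonNeg λ w →
        nonNeg*nonNeg (nonNeg*nonNeg (M≥0 u w) (nonNeg*nonNeg {sℤ u} {sℤ w} (+≤+ z≤n) (+≤+ z≤n)))
                      (square-nonNeg (y u + σ * y w))
      margin-pos : ∀ u → y u ≢ 0ℤ → 0ℤ < sℤ u * D u - Z u
      margin-pos u yu≢0 = subst (_< sℤ u * D u - Z u) (ℤP.+-inverseʳ (Z u)) (ℤP.+-monoˡ-< (- Z u) (dominant u yu≢0))
      slack-nonNeg : ∀ u → 0ℤ ≤ slack u
      slack-nonNeg u with y u ℤ.≟ 0ℤ
      ... | yes yu≡0 = ℤP.≤-reflexive (sym (begin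
        sℤ u * (y u * y u) * (sℤ u * D u - Z u)  ≡⟨ cong (λ t → sℤ u * (t * t) * (sℤ u * D u - Z u)) yu≡0 ⟩
        sℤ u * (0ℤ * 0ℤ) * (sℤ u * D u - Z u)    ≡⟨ vanish (sℤ u) (sℤ u * D u - Z u) ⟩
        0ℤ                                       ∎))
        where
        vanish : ∀ a b → a * (0ℤ * 0ℤ) * b ≡ 0ℤ
        vanish = solve-∀
      ... | no  yu≢0 = nonNeg*nonNeg (nonNeg*nonNeg {sℤ u} (+≤+ z≤n) (square-nonNeg (y u))) (ℤP.<⇒≤ (margin-pos u yu≢0))
      s₀-pos : 0ℤ < sℤ u₀
      s₀-pos with s u₀ | dominant u₀ y₀≢0
      ... | zero  | Z₀<0 = contradiction (∑-nonNeg (λ w → nonNeg*nonNeg (M≥0 u₀ w) (+≤+ z≤n))) (ℤP.<⇒≱ Z₀<0)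
      ... | suc _ | _    = +<+ (s≤s z≤n)
      slack₀-pos : 0ℤ < slack u₀
      slack₀-pos = pos*pos (pos*pos s₀-pos (square-pos y₀≢0)) (margin-pos u₀ y₀≢0)

  -- Pair counts of a design

  indicator : ∀ {v} → Subset v → Fin v → ℤ
  indicator B u = if lookup B u then 1ℤ else 0ℤ

  replication : ∀ {v} → Design v → Fin v → ℕ
  replication 𝓑 u = pairCount 𝓑 u u

  pairCount-∷ : ∀ {v} (B : Subset v) (𝓑 : Design v) u w →
    + pairCount (B ∷ 𝓑) u w ≡ indicator B u * indicator B w + + pairCount 𝓑 u w
  pairCount-∷ B 𝓑 u w with lookup B u | lookup B w
  ... | true  | true  = refl
  ... | true  | false = refl
  ... | false | _     = refl

  pairCount-sym : ∀ {v} (𝓑 : Design v) u w → pairCount 𝓑 u w ≡ pairCount 𝓑 w u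
  pairCount-sym []      u w = refl
  pairCount-sym (B ∷ 𝓑) u w =
    cong₂ ℕ._+_ (cong (if_then 1 else 0) (∧-comm (lookup B u) (lookup B w))) (pairCount-sym 𝓑 u w)

  quadraticForm-pairCount : ∀ {v} (𝓑 : Design v) (x : Fin v → ℤ) →
    quadraticForm (λ u w → + pairCount 𝓑 u w) x
      ≡ ∑[ i < List.length 𝓑 ] ((indicator (List.lookup 𝓑 i) ∙ x) * (indicator (List.lookup 𝓑 i) ∙ x))
  quadraticForm-pairCount {v} []      x = ∑-zero v λ u → ∑-zero v λ w → ℤP.*-zeroˡ (x u * x w)
  quadraticForm-pairCount {v} (B ∷ 𝓑) x = begin
    quadraticForm (λ u w → + pairCount (B ∷ 𝓑) u w) x
      ≡⟨ sum-cong-≗ (λ u → sum-cong-≗ λ w → cong (_* (x u * x w)) (pairCount-∷ B 𝓑 u w)) ⟩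
    quadraticForm (λ u w → indicator B u * indicator B w + + pairCount 𝓑 u w) x
      ≡⟨ quadraticForm-+ (λ u w → indicator B u * indicator B w) (λ u w → + pairCount 𝓑 u w) x ⟩
    quadraticForm (λ u w → indicator B u * indicator B w) x + quadraticForm (λ u w → + pairCount 𝓑 u w) x
      ≡⟨ cong₂ _+_ (quadraticForm-rank1 (indicator B) x) (quadraticForm-pairCount 𝓑 x) ⟩
    (indicator B ∙ x) * (indicator B ∙ x)
      + ∑[ i < List.length 𝓑 ] ((indicator (List.lookup 𝓑 i) ∙ x) * (indicator (List.lookup 𝓑 i) ∙ x)) ∎
    where open ≡-Reasoning

  ∑-indicator : ∀ {v} (B : Subset v) → ∑[ w < v ] indicator B w ≡ + ∣ B ∣
  ∑-indicator []          = refl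
  ∑-indicator (true  ∷ B) = cong (_+_ 1ℤ) (∑-indicator B)
  ∑-indicator (false ∷ B) = trans (ℤP.+-identityˡ _) (∑-indicator B)

  indicator-idem : ∀ {v} (B : Subset v) u → indicator B u * indicator B u ≡ indicator B u
  indicator-idem B u with lookup B u
  ... | true  = refl
  ... | false = refl

  ∑-pairCount : ∀ {v k} (𝓑 : Design v) → KUniform k 𝓑 → ∀ u →
    ∑[ w < v ] (+ pairCount 𝓑 u w) ≡ + k * + replication 𝓑 u
  ∑-pairCount {v} {k} []      []              u = trans (∑-zero v λ _ → refl) (sym (ℤP.*-zeroʳ (+ k)))
  ∑-pairCount {v} {k} (B ∷ 𝓑) (∣B∣≡k ∷ ∣𝓑∣≡k) u = begin
    ∑[ w < v ] (+ pairCount (B ∷ 𝓑) u w)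
      ≡⟨ sum-cong-≗ (pairCount-∷ B 𝓑 u) ⟩
    ∑[ w < v ] (indicator B u * indicator B w + + pairCount 𝓑 u w)
      ≡⟨ ∑-distrib-+ (λ w → indicator B u * indicator B w) (λ w → + pairCount 𝓑 u w) ⟩
    ∑[ w < v ] (indicator B u * indicator B w) + ∑[ w < v ] (+ pairCount 𝓑 u w)
      ≡⟨ cong₂ _+_ (sym (*-distribˡ-sum (indicator B u) (indicator B))) (∑-pairCount 𝓑 ∣𝓑∣≡k u) ⟩
    indicator B u * ∑[ w < v ] indicator B w + + k * R
      ≡⟨ cong (λ t → indicator B u * t + + k * R) (trans (∑-indicator B) (cong +_ ∣B∣≡k)) ⟩
    indicator B u * + k + + k * R
      ≡⟨ cong (_+ + k * R) (ℤP.*-comm (indicator B u) (+ k)) ⟩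
    + k * indicator B u + + k * R
      ≡⟨ ℤP.*-distribˡ-+ (+ k) (indicator B u) R ⟨
    + k * (indicator B u + R)
      ≡⟨ cong (λ t → + k * (t + R)) (indicator-idem B u) ⟨
    + k * (indicator B u * indicator B u + R)
      ≡⟨ cong (+ k *_) (pairCount-∷ B 𝓑 u u) ⟨
    + k * + replication (B ∷ 𝓑) u ∎
    where
    open ≡-Reasoning
    R = + replication 𝓑 u

  IsDesign⇒KUniform : ∀ {kind v k lam} {𝓑 : Design v} → IsDesign kind v k lam 𝓑 → KUniform k 𝓑
  IsDesign⇒KUniform {covering} = proj₁
  IsDesign⇒KUniform {packing}  = proj₁

  sign : Kind → ℤ
  sign covering = 1ℤ
  sign packing  = ℤ.-1ℤ

  sign²≡1 : ∀ kind → sign kind * sign kind ≡ 1ℤ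
  sign²≡1 covering = refl
  sign²≡1 packing  = refl

  μ-diag : ∀ {v} lam (𝓑 : Design v) u → μ lam 𝓑 u u ≡ 0
  μ-diag lam 𝓑 u with u ≟ u
  ... | yes _   = refl
  ... | no  u≢u = contradiction refl u≢u

  μ-≢ : ∀ {v} lam (𝓑 : Design v) {u w} → u ≢ w → μ lam 𝓑 u w ≡ ℕ.∣ pairCount 𝓑 u w - lam ∣
  μ-≢ lam 𝓑 {u} {w} u≢w with u ≟ w
  ... | yes u≡w = contradiction u≡w u≢w
  ... | no  _   = refl

  μ-sym : ∀ {v} lam (𝓑 : Design v) u w → μ lam 𝓑 u w ≡ μ lam 𝓑 w u
  μ-sym lam 𝓑 u w with u ≟ w
  ... | yes refl = sym (μ-diag lam 𝓑 u)
  ... | no  u≢w  = begin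
    ℕ.∣ pairCount 𝓑 u w - lam ∣  ≡⟨ cong (λ t → ℕ.∣ t - lam ∣) (pairCount-sym 𝓑 u w) ⟩
    ℕ.∣ pairCount 𝓑 w u - lam ∣  ≡⟨ μ-≢ lam 𝓑 (u≢w ∘ sym) ⟨
    μ lam 𝓑 w u                  ∎
    where open ≡-Reasoning

  pairCount-deviation : ∀ {kind v k lam} {𝓑 : Design v} → IsDesign kind v k lam 𝓑 → ∀ {u w} → u ≢ w →
    + pairCount 𝓑 u w ≡ + lam + sign kind * + ℕ.∣ pairCount 𝓑 u w - lam ∣
  pairCount-deviation {covering} {lam = lam} {𝓑} (_ , lam≤) {u} {w} u≢w = begin
    + P                               ≡⟨ cancel (+ P) (+ lam) ⟨
    + lam + 1ℤ * (+ P - + lam)        ≡⟨ cong (λ t → + lam + 1ℤ * t) (pos-∸ (lam≤ u w u≢w)) ⟨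
    + lam + 1ℤ * + (P ℕ.∸ lam)        ≡⟨ cong (λ t → + lam + 1ℤ * + t) (ℕP.m≤n⇒∣n-m∣≡n∸m (lam≤ u w u≢w)) ⟨
    + lam + 1ℤ * + ℕ.∣ P - lam ∣      ∎
    where
    open ≡-Reasoning
    P = pairCount 𝓑 u w
    cancel : ∀ p l → l + 1ℤ * (p - l) ≡ p
    cancel = solve-∀
  pairCount-deviation {packing} {lam = lam} {𝓑} (_ , ≤lam) {u} {w} u≢w = begin
    + P                               ≡⟨ cancel (+ P) (+ lam) ⟨
    + lam + ℤ.-1ℤ * (+ lam - + P)     ≡⟨ cong (λ t → + lam + ℤ.-1ℤ * t) (pos-∸ (≤lam u w u≢w)) ⟨
    + lam + ℤ.-1ℤ * + (lam ℕ.∸ P)     ≡⟨ cong (λ t → + lam + ℤ.-1ℤ * + t) (ℕP.m≤n⇒∣m-n∣≡n∸m (≤lam u w u≢w)) ⟨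
    + lam + ℤ.-1ℤ * + ℕ.∣ P - lam ∣   ∎
    where
    open ≡-Reasoning
    P = pairCount 𝓑 u w
    cancel : ∀ p l → l + ℤ.-1ℤ * (l - p) ≡ p
    cancel = solve-∀

  pairCount-decomposition : ∀ {kind v k lam} {𝓑 : Design v} → IsDesign kind v k lam 𝓑 → ∀ u w →
    + pairCount 𝓑 u w ≡ + lam + δ u w * (+ replication 𝓑 u - + lam) + sign kind * + μ lam 𝓑 u w
  pairCount-decomposition {kind} {lam = lam} {𝓑} design u w with u ≟ w
  ... | yes refl = sym (cancel (+ replication 𝓑 u) (+ lam) (sign kind))
    where
    cancel : ∀ r l s → l + 1ℤ * (r - l) + s * 0ℤ ≡ r
    cancel = solve-∀
  ... | no u≢w = trans (pairCount-deviation design u≢w) (cong (_+ sign kind * + ℕ.∣ pairCount 𝓑 u w - lam ∣) (sym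
                   (trans (cong (_+_ (+ lam)) (ℤP.*-zeroˡ (+ replication 𝓑 u - + lam))) (ℤP.+-identityʳ (+ lam)))))

  dominant-weights⇒∣S∣≤∣𝓑∣ : ∀ {kind v k lam} (𝓑 : Design v) → IsDesign kind v k lam 𝓑 →
    (S : Subset v) (s : Fin v → ℕ) →
    (∀ u → u ∈ S → ∑[ w < v ] (+ μ lam 𝓑 u w * + s w) < + s u * (+ replication 𝓑 u - + lam)) →
    ∣ S ∣ ℕ.≤ List.length 𝓑
  dominant-weights⇒∣S∣≤∣𝓑∣ {kind} {v} {lam = lam} 𝓑 design S s dominant =
    ℕP.≮⇒≥ (kernel⇒⊥ ∘ nonzeroKernelVector A S)
    where
    A : Fin (List.length 𝓑) → Fin v → ℤ
    A i u = indicator (List.lookup 𝓑 i) u * + s u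
    P M : Fin v → Fin v → ℤ
    P u w = + pairCount 𝓑 u w
    M u w = + μ lam 𝓑 u w
    D : Fin v → ℤ
    D u = + replication 𝓑 u - + lam
    kernel⇒⊥ : NonzeroKernelVector A S → ⊥
    kernel⇒⊥ kernel = ℤP.<-irrefl (sym form≡0) form>0
      where
      open NonzeroKernelVector kernel
      open WeightedDominance M D (sign kind) s y using (x; form-positive)
      block-sum≡0 : ∀ i → indicator (List.lookup 𝓑 i) ∙ x ≡ 0ℤ
      block-sum≡0 i = trans (sum-cong-≗ λ u → sym (ℤP.*-assoc (indicator (List.lookup 𝓑 i) u) (+ s u) (y u))) (solves i)
      form≡0 : quadraticForm P x ≡ 0ℤ
      form≡0 = trans (quadraticForm-pairCount 𝓑 x) (∑-zero (List.length 𝓑) λ i → cong (λ t → t * t) (block-sum≡0 i))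
      y≢0⇒∈S : ∀ u → y u ≢ 0ℤ → u ∈ S
      y≢0⇒∈S u yu≢0 = decidable-stable (u ∈? S) (λ u∉S → yu≢0 (supported u u∉S))
      form>0 : 0ℤ < quadraticForm P x
      form>0 = subst (0ℤ <_)
        (sym (trans (quadraticForm-structured P M (+ lam) (sign kind) D (pairCount-decomposition design) x)
                    (ℤP.+-assoc (+ lam * (sum x * sum x)) _ _)))
        (ℤP.+-mono-≤-< (nonNeg*nonNeg {+ lam} (+≤+ z≤n) (square-nonNeg (sum x)))
                       (form-positive (λ u w → cong +_ (μ-sym lam 𝓑 u w)) (λ u w → +≤+ z≤n) (sign²≡1 kind)
                                      (λ u yu≢0 → dominant u (y≢0⇒∈S u yu≢0)) witness nonzero))

  replication-equation : ∀ {kind v k lam} {𝓑 : Design v} → IsDesign kind v k lam 𝓑 → ∀ u →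
    + k * + replication 𝓑 u ≡ + v * + lam + (+ replication 𝓑 u - + lam) + sign kind * + deg lam 𝓑 u
  replication-equation {kind} {v} {k} {lam} {𝓑} design u = begin
    + k * + replication 𝓑 u
      ≡⟨ ∑-pairCount 𝓑 (IsDesign⇒KUniform design) u ⟨
    ∑[ w < v ] (+ pairCount 𝓑 u w)
      ≡⟨ sum-cong-≗ (pairCount-decomposition design u) ⟩
    ∑[ w < v ] (+ lam + δ u w * D + σ * + μ lam 𝓑 u w)
      ≡⟨ ∑-distrib-+ (λ w → + lam + δ u w * D) (λ w → σ * + μ lam 𝓑 u w) ⟩
    ∑[ w < v ] (+ lam + δ u w * D) + ∑[ w < v ] (σ * + μ lam 𝓑 u w)
      ≡⟨ cong₂ _+_ (∑-distrib-+ (λ _ → + lam) (λ w → δ u w * D)) (sym (*-distribˡ-sum σ (λ w → + μ lam 𝓑 u w))) ⟩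
    ∑[ w < v ] (+ lam) + ∑[ w < v ] (δ u w * D) + σ * ∑[ w < v ] (+ μ lam 𝓑 u w)
      ≡⟨ cong₂ (λ a b → a + b + σ * ∑[ w < v ] (+ μ lam 𝓑 u w)) (∑-const v (+ lam)) (∑-δ u (λ _ → D)) ⟩
    + v * + lam + D + σ * ∑[ w < v ] (+ μ lam 𝓑 u w)
      ≡⟨ cong (λ t → + v * + lam + D + σ * t) (pos-sumℕ (μ lam 𝓑 u)) ⟨
    + v * + lam + D + σ * + deg lam 𝓑 u ∎
    where
    open ≡-Reasoning
    σ = sign kind
    D = + replication 𝓑 u - + lam

  IsRD-signed : ∀ {kind v k lam r d} → IsRD kind v k lam r d →
    + lam * + (v ℕ.∸ 1) ≡ + r * + (k ℕ.∸ 1) - sign kind * + d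
  IsRD-signed {covering} {v} {k} {lam} {r} {d} (lam[v-1]+d≡r[k-1] , _) = begin
    + lam * + (v ℕ.∸ 1)                     ≡⟨ ℤP.pos-* lam (v ℕ.∸ 1) ⟨
    + (lam ℕ.* (v ℕ.∸ 1))                   ≡⟨ cancel (+ (lam ℕ.* (v ℕ.∸ 1))) (+ d) ⟨
    + (lam ℕ.* (v ℕ.∸ 1)) + + d - 1ℤ * + d  ≡⟨ cong (_- 1ℤ * + d) (ℤP.pos-+ (lam ℕ.* (v ℕ.∸ 1)) d) ⟨
    + (lam ℕ.* (v ℕ.∸ 1) ℕ.+ d) - 1ℤ * + d  ≡⟨ cong (λ t → + t - 1ℤ * + d) lam[v-1]+d≡r[k-1] ⟩
    + (r ℕ.* (k ℕ.∸ 1)) - 1ℤ * + d          ≡⟨ cong (_- 1ℤ * + d) (ℤP.pos-* r (k ℕ.∸ 1)) ⟩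
    + r * + (k ℕ.∸ 1) - 1ℤ * + d            ∎
    where
    open ≡-Reasoning
    cancel : ∀ a b → a + b - 1ℤ * b ≡ a
    cancel = solve-∀
  IsRD-signed {packing} {v} {k} {lam} {r} {d} (lam[v-1]≡r[k-1]+d , _) = begin
    + lam * + (v ℕ.∸ 1)                     ≡⟨ ℤP.pos-* lam (v ℕ.∸ 1) ⟨
    + (lam ℕ.* (v ℕ.∸ 1))                   ≡⟨ cong +_ lam[v-1]≡r[k-1]+d ⟩
    + (r ℕ.* (k ℕ.∸ 1) ℕ.+ d)               ≡⟨ ℤP.pos-+ (r ℕ.* (k ℕ.∸ 1)) d ⟩
    + (r ℕ.* (k ℕ.∸ 1)) + + d               ≡⟨ cong (_+ + d) (ℤP.pos-* r (k ℕ.∸ 1)) ⟩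
    + r * + (k ℕ.∸ 1) + + d                 ≡⟨ negate (+ r * + (k ℕ.∸ 1)) (+ d) ⟩
    + r * + (k ℕ.∸ 1) - ℤ.-1ℤ * + d         ∎
    where
    open ≡-Reasoning
    negate : ∀ a b → a + b ≡ a - ℤ.-1ℤ * b
    negate = solve-∀

  replication-Vᵢ : ∀ {kind v k lam r d} {𝓑 : Design v} → 2 ℕ.≤ k → IsDesign kind v k lam 𝓑 → IsRD kind v k lam r d →
    ∀ i u → deg lam 𝓑 u ≡ d ℕ.+ i ℕ.* (k ℕ.∸ 1) → + replication 𝓑 u ≡ + r + sign kind * + i
  replication-Vᵢ {kind} {suc v} {suc (suc k)} {lam} {r} {d} {𝓑} (s≤s (s≤s z≤n)) design rd i u deg≡ =
    ℤP.*-cancelˡ-≡ K R (+ r + σ * + i) (begin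
      K * R                                      ≡⟨ peel K R ⟩
      (1ℤ + K) * R - R                           ≡⟨ cong (_- R) (replication-equation design u) ⟩
      (1ℤ + + v) * L + (R - L) + σ * Deg - R     ≡⟨ collect (+ v) L R σ Deg ⟩
      L * + v + σ * Deg                          ≡⟨ cong₂ (λ a b → a + σ * b) (IsRD-signed rd) Deg≡d+iK ⟩
      + r * K - σ * + d + σ * (+ d + + i * K)    ≡⟨ factor K (+ r) σ (+ d) (+ i) ⟩
      K * (+ r + σ * + i)                        ∎)
    where
    open ≡-Reasoning
    K = + suc k
    L = + lam
    R = + replication 𝓑 u
    Deg = + deg lam 𝓑 u
    σ = sign kind
    Deg≡d+iK : Deg ≡ + d + + i * K
    Deg≡d+iK = trans (cong +_ deg≡) (trans (ℤP.pos-+ d (i ℕ.* suc k)) (cong (_+_ (+ d)) (ℤP.pos-* i (suc k))))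
    peel : ∀ K R → K * R ≡ (1ℤ + K) * R - R
    peel = solve-∀
    collect : ∀ V L R σ D → (1ℤ + V) * L + (R - L) + σ * D - R ≡ L * V + σ * D
    collect = solve-∀
    factor : ∀ K r σ d i → r * K - σ * d + σ * (d + i * K) ≡ K * (r + σ * i)
    factor = solve-∀

  inV⇒deg : ∀ {v} k lam d i (𝓑 : Design v) u → inV k lam d i 𝓑 u ≡ true → deg lam 𝓑 u ≡ d ℕ.+ i ℕ.* (k ℕ.∸ 1)
  inV⇒deg k lam d i 𝓑 u u∈Vᵢ with deg lam 𝓑 u ℕ.≟ d ℕ.+ i ℕ.* (k ℕ.∸ 1)
  ... | yes deg≡ = deg≡
  ... | no  _    = contradiction u∈Vᵢ λ ()

  V₁⇒∉V₀ : ∀ {v k lam d} {𝓑 : Design v} {u} → 2 ℕ.≤ k → inV k lam d 1 𝓑 u ≡ true → inV k lam d 0 𝓑 u ≡ false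
  V₁⇒∉V₀ {k = suc (suc k)} {lam} {d} {𝓑} {u} (s≤s (s≤s z≤n)) u∈V₁ with deg lam 𝓑 u ℕ.≟ d ℕ.+ 0
  ... | no  _       = refl
  ... | yes deg≡d+0 = contradiction (ℕP.+-cancelˡ-≡ d 0 (suc k ℕ.+ 0) d+0≡d+[k-1]) λ ()
    where
    d+0≡d+[k-1] : d ℕ.+ 0 ≡ d ℕ.+ (suc k ℕ.+ 0)
    d+0≡d+[k-1] = trans (sym deg≡d+0) (inV⇒deg (suc (suc k)) lam d 1 𝓑 u u∈V₁)

  mOf-signed : ∀ kind {r lam} → lam ℕ.< r → + mOf kind r lam ≡ + r + sign kind * + 1 - + lam
  mOf-signed covering {r} {lam} lam<r = begin
    + (r ℕ.∸ lam ℕ.+ 1)       ≡⟨ ℤP.pos-+ (r ℕ.∸ lam) 1 ⟩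
    + (r ℕ.∸ lam) + 1ℤ        ≡⟨ cong (_+ 1ℤ) (pos-∸ (ℕP.<⇒≤ lam<r)) ⟩
    + r - + lam + 1ℤ          ≡⟨ reorder (+ r) (+ lam) ⟩
    + r + 1ℤ * 1ℤ - + lam     ∎
    where
    open ≡-Reasoning
    reorder : ∀ r l → r - l + 1ℤ ≡ r + 1ℤ * 1ℤ - l
    reorder = solve-∀
  mOf-signed packing {r} {lam} lam<r = begin
    + (r ℕ.∸ lam ℕ.∸ 1)       ≡⟨ pos-∸ (ℕP.m<n⇒0<n∸m lam<r) ⟩
    + (r ℕ.∸ lam) - 1ℤ        ≡⟨ cong (_- 1ℤ) (pos-∸ (ℕP.<⇒≤ lam<r)) ⟩
    + r - + lam - 1ℤ          ≡⟨ reorder (+ r) (+ lam) ⟩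
    + r + ℤ.-1ℤ * 1ℤ - + lam  ∎
    where
    open ≡-Reasoning
    reorder : ∀ r l → r - l - 1ℤ ≡ r + ℤ.-1ℤ * 1ℤ - l
    reorder = solve-∀

  -- Rational weights

  toℚᵘ-toℚ : ∀ n → ℚ.toℚᵘ (toℚ n) ℚᵘ.≃ mkℚᵘ (+ n) 0
  toℚᵘ-toℚ n = ℚP.toℚᵘ-fromℚᵘ (mkℚᵘ (+ n) 0)

  toℚ-+ : ∀ m n → toℚ (m ℕ.+ n) ≡ toℚ m ℚ.+ toℚ n
  toℚ-+ m n = ℚP.toℚᵘ-injective (ℚᵘP.≃-trans (toℚᵘ-toℚ (m ℕ.+ n)) (ℚᵘP.≃-trans (*≡* integral)
    (ℚᵘP.≃-sym (ℚᵘP.≃-trans (ℚP.toℚᵘ-homo-+ (toℚ m) (toℚ n)) (ℚᵘP.+-cong (toℚᵘ-toℚ m) (toℚᵘ-toℚ n))))))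
    where
    unit : ∀ a b → (a * 1ℤ + b * 1ℤ) * 1ℤ ≡ a + b
    unit = solve-∀
    integral : + (m ℕ.+ n) * 1ℤ ≡ (+ m * 1ℤ + + n * 1ℤ) * 1ℤ
    integral = trans (ℤP.*-identityʳ (+ (m ℕ.+ n))) (trans (ℤP.pos-+ m n) (sym (unit (+ m) (+ n))))

  toℚ-* : ∀ m n → toℚ (m ℕ.* n) ≡ toℚ m ℚ.* toℚ n
  toℚ-* m n = ℚP.toℚᵘ-injective (ℚᵘP.≃-trans (toℚᵘ-toℚ (m ℕ.* n)) (ℚᵘP.≃-trans (*≡* (cong (_* 1ℤ) (ℤP.pos-* m n)))
    (ℚᵘP.≃-sym (ℚᵘP.≃-trans (ℚP.toℚᵘ-homo-* (toℚ m) (toℚ n)) (ℚᵘP.*-cong (toℚᵘ-toℚ m) (toℚᵘ-toℚ n))))))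

  toℚ-cancel-< : ∀ {m n} → toℚ m ℚ.< toℚ n → m ℕ.< n
  toℚ-cancel-< {m} {n} m<n with ℚᵘP.<-respˡ-≃ (toℚᵘ-toℚ m) (ℚᵘP.<-respʳ-≃ (toℚᵘ-toℚ n) (ℚP.toℚᵘ-mono-< m<n))
  ... | *<* m*1<n*1 = ℤP.drop‿+<+ (subst₂ _<_ (ℤP.*-identityʳ (+ m)) (ℤP.*-identityʳ (+ n)) m*1<n*1)

  toℚ-nonNeg : ∀ n → 0ℚ ℚ.≤ toℚ n
  toℚ-nonNeg n = ℚP.nonNegative⁻¹ (toℚ n) {{ℚP.normalize-nonNeg n 1}}

  toℚ-suc-positive : ∀ n → ℚ.Positive (toℚ (suc n))
  toℚ-suc-positive n = ℚP.normalize-pos (suc n) 1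

  toℚ-sumℕ : ∀ {n} (f : Fin n → ℕ) → toℚ (sumℕ f) ≡ sumℚ (λ i → toℚ (f i))
  toℚ-sumℕ {zero}  f = refl
  toℚ-sumℕ {suc n} f = trans (toℚ-+ (f zero) (sumℕ (λ i → f (suc i))))
                             (cong (ℚ._+_ (toℚ (f zero))) (toℚ-sumℕ (λ i → f (suc i))))

  *-distribˡ-sumℚ : ∀ {n} (a : ℚ) (f : Fin n → ℚ) → a ℚ.* sumℚ f ≡ sumℚ (λ i → a ℚ.* f i)
  *-distribˡ-sumℚ {zero}  a f = ℚP.*-zeroʳ a
  *-distribˡ-sumℚ {suc n} a f = trans (ℚP.*-distribˡ-+ a (f zero) (sumℚ (λ i → f (suc i))))
                                      (cong (ℚ._+_ (a ℚ.* f zero)) (*-distribˡ-sumℚ a (λ i → f (suc i))))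

  sumℚ-cong : ∀ {n} {f g : Fin n → ℚ} → (∀ i → f i ≡ g i) → sumℚ f ≡ sumℚ g
  sumℚ-cong {zero}  f≗g = refl
  sumℚ-cong {suc n} f≗g = cong₂ ℚ._+_ (f≗g zero) (sumℚ-cong (λ i → f≗g (suc i)))

  clear-denominator : ∀ (c : ℚ) a b → toℚ a ℚ.< c ℚ.* toℚ b → ∃ λ p → ∃ λ q → toℚ (suc q) ℚ.* c ≡ toℚ p
  clear-denominator c@(mkℚ -[1+ _ ] _ _) a b a<cb =
    ⊥-elim (ℚP.<-irrefl refl (ℚP.≤-<-trans (toℚ-nonNeg a) (ℚP.<-≤-trans a<cb cb≤0)))
    where
    cb≤0 : c ℚ.* toℚ b ℚ.≤ 0ℚ
    cb≤0 = ℚP.≤-trans (ℚP.*-monoʳ-≤-nonNeg (toℚ b) {{ℚP.normalize-nonNeg b 1}} (ℚP.nonPositive⁻¹ c {{ℚP.neg⇒nonPos c}}))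
                      (ℚP.≤-reflexive (ℚP.*-zeroˡ (toℚ b)))
  clear-denominator c@(mkℚ (+ p) q _) _ _ _ = p , q , ℚP.toℚᵘ-injective
    (ℚᵘP.≃-trans (ℚP.toℚᵘ-homo-* (toℚ (suc q)) c)
    (ℚᵘP.≃-trans (ℚᵘP.*-cong (toℚᵘ-toℚ (suc q)) (ℚᵘP.≃-refl {mkℚᵘ (+ p) q}))
    (ℚᵘP.≃-trans (*≡* cross) (ℚᵘP.≃-sym (toℚᵘ-toℚ p)))))
    where
    cross : + suc q * + p * 1ℤ ≡ + p * + suc (q ℕ.+ 0)
    cross = trans (ℤP.*-identityʳ (+ suc q * + p))
                  (trans (ℤP.*-comm (+ suc q) (+ p)) (cong (λ t → + p * + suc t) (sym (ℕP.+-identityʳ q))))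

  numerator<denominator : ∀ {c p q} → toℚ (suc q) ℚ.* c ≡ toℚ p → c ℚ.< toℚ 1 → p ℕ.< suc q
  numerator<denominator {c} {p} {q} qc≡p c<1 = toℚ-cancel-< (subst₂ ℚ._<_ qc≡p (ℚP.*-identityʳ (toℚ (suc q)))
    (ℚP.*-monoʳ-<-pos (toℚ (suc q)) {{toℚ-suc-positive q}} c<1))

  clear-denominator-< : ∀ {c p q} a b → toℚ (suc q) ℚ.* c ≡ toℚ p → toℚ a ℚ.< c ℚ.* toℚ b → a ℕ.* suc q ℕ.< p ℕ.* b
  clear-denominator-< {c} {p} {q} a b qc≡p a<cb =
    toℚ-cancel-< (subst₂ ℚ._<_ qa≡aq qcb≡pb (ℚP.*-monoʳ-<-pos (toℚ (suc q)) {{toℚ-suc-positive q}} a<cb))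
    where
    qa≡aq : toℚ (suc q) ℚ.* toℚ a ≡ toℚ (a ℕ.* suc q)
    qa≡aq = trans (sym (toℚ-* (suc q) a)) (cong toℚ (ℕP.*-comm (suc q) a))
    qcb≡pb : toℚ (suc q) ℚ.* (c ℚ.* toℚ b) ≡ toℚ (p ℕ.* b)
    qcb≡pb = trans (sym (ℚP.*-assoc (toℚ (suc q)) c (toℚ b))) (trans (cong (ℚ._* toℚ b) qc≡p) (sym (toℚ-* p b)))

  wtG*-V₁ : ∀ {v k lam d c} {𝓑 : Design v} {u w} → 2 ℕ.≤ k → inV k lam d 1 𝓑 u ≡ true →
    wtG* k lam d c 𝓑 u w ≡ (if inV k lam d 1 𝓑 w then toℚ (μ lam 𝓑 u w) else c ℚ.* toℚ (μ lam 𝓑 u w))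
  wtG*-V₁ {k = k} {lam} {d} {c} {𝓑} {u} {w} 2≤k u∈V₁ = cong₂
    (λ a b → if a ∧ inV k lam d 1 𝓑 w then toℚ (μ lam 𝓑 u w)
             else if b ∧ inV k lam d 0 𝓑 w then 0ℚ else c ℚ.* toℚ (μ lam 𝓑 u w))
    u∈V₁ (V₁⇒∉V₀ {𝓑 = 𝓑} 2≤k u∈V₁)

  module Weights {kind v k lam r d} {𝓑 : Design v} (2≤k : 2 ℕ.≤ k) (design : IsDesign kind v k lam 𝓑)
                 (rd : IsRD kind v k lam r d) (lam<r : lam ℕ.< r) (S : Subset v) (p q : ℕ) where

    -- For c = p / suc q.  Vanishing off S makes the dominance sums range over S only.
    weight : Fin v → ℕ
    weight w = if lookup S w then (if inV k lam d 1 𝓑 w then suc q else p) else 0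

    weight-V₁ : ∀ {u} → u ∈ S → inV k lam d 1 𝓑 u ≡ true → weight u ≡ suc q
    weight-V₁ u∈S u∈V₁ = cong₂ (λ a b → if a then (if b then suc q else p) else 0) ([]=⇒lookup u∈S) u∈V₁

    weight-V₀ : ∀ {u} → u ∈ S → inV k lam d 1 𝓑 u ≡ false → weight u ≡ p
    weight-V₀ u∈S u∉V₁ = cong₂ (λ a b → if a then (if b then suc q else p) else 0) ([]=⇒lookup u∈S) u∉V₁

    weight≤ : p ℕ.≤ suc q → ∀ w → weight w ℕ.≤ suc q
    weight≤ p≤q w with lookup S w | inV k lam d 1 𝓑 w
    ... | true  | true  = ℕP.≤-refl
    ... | true  | false = p≤q
    ... | false | _     = z≤n

    scaled-summand : ∀ {c} → toℚ (suc q) ℚ.* c ≡ toℚ p → ∀ (inS diag v₁ : Bool) (m : ℕ) → (diag ≡ true → m ≡ 0) →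
      toℚ (suc q) ℚ.* (if inS ∧ not diag then (if v₁ then toℚ m else c ℚ.* toℚ m) else 0ℚ)
        ≡ toℚ (m ℕ.* (if inS then (if v₁ then suc q else p) else 0))
    scaled-summand _    false _     _     m _   = trans (ℚP.*-zeroʳ (toℚ (suc q))) (cong toℚ (sym (ℕP.*-zeroʳ m)))
    scaled-summand _    true  true  v₁    m m≡0 =
      trans (ℚP.*-zeroʳ (toℚ (suc q))) (cong (λ t → toℚ (t ℕ.* (if v₁ then suc q else p))) (sym (m≡0 refl)))
    scaled-summand _    true  false true  m _   = trans (sym (toℚ-* (suc q) m)) (cong toℚ (ℕP.*-comm (suc q) m))
    scaled-summand {c} qc≡p true false false m _ = begin
      toℚ (suc q) ℚ.* (c ℚ.* toℚ m)  ≡⟨ ℚP.*-assoc (toℚ (suc q)) c (toℚ m) ⟨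
      toℚ (suc q) ℚ.* c ℚ.* toℚ m    ≡⟨ cong (ℚ._* toℚ m) qc≡p ⟩
      toℚ p ℚ.* toℚ m                ≡⟨ toℚ-* p m ⟨
      toℚ (p ℕ.* m)                  ≡⟨ cong toℚ (ℕP.*-comm p m) ⟩
      toℚ (m ℕ.* p)                  ∎
      where open ≡-Reasoning

    scaled-wtIn : ∀ {c u} → toℚ (suc q) ℚ.* c ≡ toℚ p → inV k lam d 1 𝓑 u ≡ true →
      toℚ (suc q) ℚ.* wtIn k lam d c 𝓑 S u ≡ toℚ (sumℕ (λ w → μ lam 𝓑 u w ℕ.* weight w))
    scaled-wtIn {c} {u} qc≡p u∈V₁ = begin
      toℚ (suc q) ℚ.* sumℚ summand       ≡⟨ *-distribˡ-sumℚ (toℚ (suc q)) summand ⟩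
      sumℚ (λ w → toℚ (suc q) ℚ.* summand w)
        ≡⟨ sumℚ-cong scaled ⟩
      sumℚ (λ w → toℚ (μ lam 𝓑 u w ℕ.* weight w))
        ≡⟨ toℚ-sumℕ (λ w → μ lam 𝓑 u w ℕ.* weight w) ⟨
      toℚ (sumℕ (λ w → μ lam 𝓑 u w ℕ.* weight w)) ∎
      where
      open ≡-Reasoning
      summand : Fin v → ℚ
      summand w = if lookup S w ∧ not ⌊ u ≟ w ⌋ then wtG* k lam d c 𝓑 u w else 0ℚ
      scaled : ∀ w → toℚ (suc q) ℚ.* summand w ≡ toℚ (μ lam 𝓑 u w ℕ.* weight w)
      scaled w = trans (cong (λ t → toℚ (suc q) ℚ.* (if lookup S w ∧ not ⌊ u ≟ w ⌋ then t else 0ℚ))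
                             (wtG*-V₁ {c = c} {𝓑} {w = w} 2≤k u∈V₁))
                       (scaled-summand qc≡p (lookup S w) ⌊ u ≟ w ⌋ (inV k lam d 1 𝓑 w) (μ lam 𝓑 u w)
                                       (cong (if_then 0 else ℕ.∣ pairCount 𝓑 u w - lam ∣)))

    dominant-V₁ : ∀ {c} → toℚ (suc q) ℚ.* c ≡ toℚ p → MIndependent k lam d c 𝓑 (toℚ (mOf kind r lam)) S →
      ∀ u → u ∈ S → inV k lam d 1 𝓑 u ≡ true →
      ∑[ w < v ] (+ μ lam 𝓑 u w * + weight w) < + weight u * (+ replication 𝓑 u - + lam)
    dominant-V₁ qc≡p independent u u∈S u∈V₁ = subst₂ _<_
      (trans (pos-sumℕ (λ w → μ lam 𝓑 u w ℕ.* weight w)) (sum-cong-≗ λ w → ℤP.pos-* (μ lam 𝓑 u w) (weight w)))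
      (begin
        + (suc q ℕ.* mOf kind r lam)
          ≡⟨ ℤP.pos-* (suc q) (mOf kind r lam) ⟩
        + suc q * + mOf kind r lam
          ≡⟨ cong₂ _*_ (cong +_ (weight-V₁ u∈S u∈V₁)) (sym (mOf-signed kind lam<r)) ⟨
        + weight u * (+ r + sign kind * + 1 - + lam)
          ≡⟨ cong (λ t → + weight u * (t - + lam)) (replication-Vᵢ 2≤k design rd 1 u (inV⇒deg k lam d 1 𝓑 u u∈V₁)) ⟨
        + weight u * (+ replication 𝓑 u - + lam) ∎)
      (+<+ (toℚ-cancel-< (subst₂ ℚ._<_ (scaled-wtIn qc≡p u∈V₁) (sym (toℚ-* (suc q) (mOf kind r lam)))
                                       (ℚP.*-monoʳ-<-pos (toℚ (suc q)) {{toℚ-suc-positive q}} (independent u u∈S)))))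
      where open ≡-Reasoning

    dominant-V₀ : p ℕ.≤ suc q → d ℕ.* suc q ℕ.< p ℕ.* (r ℕ.∸ lam) →
      ∀ u → u ∈ S → inV k lam d 0 𝓑 u ≡ true → inV k lam d 1 𝓑 u ≡ false →
      ∑[ w < v ] (+ μ lam 𝓑 u w * + weight w) < + weight u * (+ replication 𝓑 u - + lam)
    dominant-V₀ p≤q dq<pR u u∈S u∈V₀ u∉V₁ = begin-strict
      ∑[ w < v ] (+ μ lam 𝓑 u w * + weight w)
        ≤⟨ ∑-mono-≤ (λ w → ℤP.*-monoˡ-≤-nonNeg (+ μ lam 𝓑 u w) (+≤+ (weight≤ p≤q w))) ⟩
      ∑[ w < v ] (+ μ lam 𝓑 u w * + suc q)
        ≡⟨ *-distribʳ-sum (+ suc q) (λ w → + μ lam 𝓑 u w) ⟨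
      ∑[ w < v ] (+ μ lam 𝓑 u w) * + suc q
        ≡⟨ cong (_* + suc q) (pos-sumℕ (μ lam 𝓑 u)) ⟨
      + deg lam 𝓑 u * + suc q
        ≡⟨ cong (λ t → + t * + suc q) (trans (inV⇒deg k lam d 0 𝓑 u u∈V₀) (ℕP.+-identityʳ d)) ⟩
      + d * + suc q
        ≡⟨ ℤP.pos-* d (suc q) ⟨
      + (d ℕ.* suc q)
        <⟨ +<+ dq<pR ⟩
      + (p ℕ.* (r ℕ.∸ lam))
        ≡⟨ ℤP.pos-* p (r ℕ.∸ lam) ⟩
      + p * + (r ℕ.∸ lam)
        ≡⟨ cong₂ _*_ (cong +_ (weight-V₀ u∈S u∉V₁)) (sym (pos-∸ (ℕP.<⇒≤ lam<r))) ⟨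
      + weight u * (+ r - + lam)
        ≡⟨ cong (λ t → + weight u * (t - + lam)) (trans (cong (_+_ (+ r)) (ℤP.*-zeroʳ (sign kind))) (ℤP.+-identityʳ (+ r))) ⟨
      + weight u * (+ r + sign kind * + 0 - + lam)
        ≡⟨ cong (λ t → + weight u * (t - + lam)) (replication-Vᵢ 2≤k design rd 0 u (inV⇒deg k lam d 0 𝓑 u u∈V₀)) ⟨
      + weight u * (+ replication 𝓑 u - + lam) ∎
      where open ℤP.≤-Reasoning

    dominant : ∀ {c} → toℚ (suc q) ℚ.* c ≡ toℚ p → MIndependent k lam d c 𝓑 (toℚ (mOf kind r lam)) S →
      p ℕ.≤ suc q → d ℕ.* suc q ℕ.< p ℕ.* (r ℕ.∸ lam) → InVertexSet k lam d 𝓑 S →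
      ∀ u → u ∈ S → ∑[ w < v ] (+ μ lam 𝓑 u w * + weight w) < + weight u * (+ replication 𝓑 u - + lam)
    dominant qc≡p independent p≤q dq<pR S⊆V₀∪V₁ u u∈S = by-V₁-membership (inV k lam d 1 𝓑 u) refl
      where
      by-V₁-membership : ∀ b → inV k lam d 1 𝓑 u ≡ b →
        ∑[ w < v ] (+ μ lam 𝓑 u w * + weight w) < + weight u * (+ replication 𝓑 u - + lam)
      by-V₁-membership true  u∈V₁ = dominant-V₁ qc≡p independent u u∈S u∈V₁
      by-V₁-membership false u∉V₁ = dominant-V₀ p≤q dq<pR u u∈S u∈V₀ u∉V₁
        where
        u∈V₀ : inV k lam d 0 𝓑 u ≡ true
        u∈V₀ = [ id , (λ u∈V₁ → contradiction (trans (sym u∈V₁) u∉V₁) λ ()) ]′ (S⊆V₀∪V₁ u u∈S)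

open import Data.Nat using (ℕ; _+_; _∸_; _≤_; _<_)
open import Data.List using (length)
open import Data.Fin.Subset using (Subset; ∣_∣)
open import Data.Rational using (ℚ)
import Data.Rational as ℚ
import Data.Nat.Properties as ℕP
open import Data.Product using (_,_)

lemma6p1 : (kind : Kind) (v k lam : ℕ) → 1 ≤ lam → 3 ≤ k → k < v →
    (𝓑 : Design v) → IsDesign kind v k lam 𝓑 →
    (r d : ℕ) → IsRD kind v k lam r d → d + lam < r →
    (c : ℚ) → toℚ d ℚ.< c ℚ.* toℚ (r ∸ lam) → c ℚ.< toℚ 1 →
    (S : Subset v) → InVertexSet k lam d 𝓑 S → MIndependent k lam d c 𝓑 (toℚ (mOf kind r lam)) S →
    ∣ S ∣ ≤ length 𝓑
lemma6p1 kind v k lam _ 3≤k _ 𝓑 design r d rd d+lam<r c d<c[r-lam] c<1 S S⊆V₀∪V₁ independent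
  with clear-denominator c d (r ∸ lam) d<c[r-lam]
... | p , q , qc≡p = dominant-weights⇒∣S∣≤∣𝓑∣ 𝓑 design S weight
        (dominant qc≡p independent (ℕP.<⇒≤ (numerator<denominator qc≡p c<1))
                  (clear-denominator-< {p = p} d (r ∸ lam) qc≡p d<c[r-lam]) S⊆V₀∪V₁)
  where open Weights (ℕP.<⇒≤ 3≤k) design rd (ℕP.≤-<-trans (ℕP.m≤n+m lam d) d+lam<r) S p q
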